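{- Let $K = \mathbb{Q}(\sqrt{ -7})$ with a fixed square root $\sqrt{ -7}$, and let $\theta = \frac{1+\sqrt{ -7}}{2}$ and $\theta' = \frac{1-\sqrt{ -7}}{2} = 1-\theta$, regarded as elements of the ring of integers $\mathcal{O}_K$. For every integer $x$ and every odd natural number $m \geq 3$, if $\left\lfloor \frac{x^2+7}{4} \right\rfloor = 2^m$, then $-2\theta + 1 = \theta^m - \theta'^m$ in $\mathcal{O}_K$ (equivalently, $-\sqrt{ -7} = \theta^m - \theta'^m$).
   Context: Here $\lfloor\cdot\rfloor$ denotes integer division of $x^2+7$ by $4$ (rounding down). The element $\theta$ satisfies $\theta^2 = \theta - 2$. -}

module Defs where

open import Data.Nat using (ℕ; zero; suc)
open import Data.Integer using (ℤ; +_; -_) renaming (_+_ to _+ℤ_; _*_ to _*ℤ_; _-_ to _-ℤ_)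

-- The ring of integers O_K of K = Q(√-7) is Z[θ] with θ = (1+√-7)/2,
-- θ² = θ - 2.  An element  a + b θ  (a b : ℤ) is represented as ⟨ a , b ⟩.
record 𝒪 : Set where
  constructor ⟨_,_⟩
  field
    re : ℤ
    th : ℤ

open 𝒪 public

infixl 6 _+𝒪_ _-𝒪_
infixl 7 _*𝒪_
infixr 8 _^𝒪_

_+𝒪_ : 𝒪 → 𝒪 → 𝒪
⟨ a , b ⟩ +𝒪 ⟨ c , d ⟩ = ⟨ a +ℤ c , b +ℤ d ⟩

-𝒪_ : 𝒪 → 𝒪
-𝒪 ⟨ a , b ⟩ = ⟨ - a , - b ⟩

_-𝒪_ : 𝒪 → 𝒪 → 𝒪
x -𝒪 y = x +𝒪 (-𝒪 y)

-- (a + bθ)(c + dθ) = ac + (ad + bc)θ + bd θ² = (ac - 2bd) + (ad + bc + bd)θ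
_*𝒪_ : 𝒪 → 𝒪 → 𝒪
⟨ a , b ⟩ *𝒪 ⟨ c , d ⟩ =
  ⟨ (a *ℤ c) -ℤ (+ 2 *ℤ (b *ℤ d)) , (a *ℤ d) +ℤ (b *ℤ c) +ℤ (b *ℤ d) ⟩

ι : ℤ → 𝒪
ι n = ⟨ n , + 0 ⟩

𝟙 : 𝒪
𝟙 = ι (+ 1)

_^𝒪_ : 𝒪 → ℕ → 𝒪
x ^𝒪 zero = 𝟙
x ^𝒪 suc n = x *𝒪 (x ^𝒪 n)

θ : 𝒪
θ = ⟨ + 0 , + 1 ⟩

θ' : 𝒪
θ' = 𝟙 -𝒪 θ

-- Write x = 2j + 1 (even x is excluded modulo 4), so that the norm of j + θ is
-- j² + j + 2 = 2^m.  In 𝒪 = ℤ[θ] the prime 2 splits as θθ', and dividing by θ or θ'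
-- one step at a time shows that an element of norm 2^m not divisible by 2 is ±θ^m or
-- ±θ'^m.  Comparing θ-coordinates, θ^m - θ'^m = τ √-7 with τ = ±1; the recurrence
-- τ(n+2) = τ(n+1) - 2τ(n) gives τ ≡ 3 (mod 4) at odd m ≥ 3, hence τ = -1.

module Submission where

open import Defs
open import Data.Nat using (ℕ; _≥_) renaming (_+_ to _+ℕ_; _*_ to _*ℕ_; _^_ to _^ℕ_)
open import Data.Integer using (ℤ; +_; _+_; _*_)
open import Data.Integer.DivMod using (_/_)
open import Data.Product using (∃)
open import Relation.Binary.PropositionalEquality using (_≡_)

open import Data.Nat as ℕ using (zero; suc; s≤s)
import Data.Nat.Properties as ℕ
import Data.Nat.DivMod as ℕ
open import Data.Nat.Divisibility using (n∣m*n)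
import Data.Nat.Tactic.RingSolver as ℕ-Solver
open import Data.Integer using (-_; _-_; -[1+_]; ∣_∣; _%_)
open import Data.Integer.Properties
  using (pos-+; pos-*; abs-*; *-cancelˡ-≡; *-identityʳ; ∣i∣≡0⇒i≡0; +-injective; neg-involutive; neg-injective)
open import Data.Integer.DivMod using (n%d<d; a≡a%n+[a/n]*n; div-pos-is-/ℕ)
open import Data.Integer.Tactic.RingSolver using (solve-∀; solve)
open import Data.List using (_∷_; [])
open import Data.Empty using (⊥-elim)
open import Data.Product using (_,_; _×_)
open import Data.Sum using (_⊎_; inj₁; inj₂; swap) renaming (map to ⊎-map)
open import Function using (_∘_)
open import Relation.Nullary using (¬_; contradiction)
open import Relation.Nullary.Decidable using (from-no)
open import Relation.Binary.PropositionalEquality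
  using (_≢_; refl; sym; trans; cong; cong₂; subst; module ≡-Reasoning)
open ≡-Reasoning

data Parityℕ : ℕ → Set where
  even : ∀ j → Parityℕ (2 *ℕ j)
  odd  : ∀ j → Parityℕ (1 +ℕ 2 *ℕ j)

parityℕ : ∀ n → Parityℕ n
parityℕ zero = even 0
parityℕ (suc n) with parityℕ n
... | even j = odd j
... | odd j = subst Parityℕ (ℕ.*-suc 2 j) (even (suc j))

n²+1≢4*q : ∀ n q → n *ℕ n +ℕ 1 ≢ 4 *ℕ q
n²+1≢4*q n q n²+1≡4q with parityℕ n
... | even i = ℕ.even≢odd (2 *ℕ q) (2 *ℕ (i *ℕ i)) (begin
  2 *ℕ (2 *ℕ q)                   ≡⟨ ℕ-Solver.solve (q ∷ []) ⟩
  4 *ℕ q                          ≡⟨ n²+1≡4q ⟨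
  2 *ℕ i *ℕ (2 *ℕ i) +ℕ 1         ≡⟨ ℕ-Solver.solve (i ∷ []) ⟩
  1 +ℕ 2 *ℕ (2 *ℕ (i *ℕ i))       ∎)
... | odd i = ℕ.even≢odd q (i *ℕ i +ℕ i) (ℕ.*-cancelˡ-≡ (2 *ℕ q) (1 +ℕ 2 *ℕ (i *ℕ i +ℕ i)) 2 (begin
  2 *ℕ (2 *ℕ q)                                ≡⟨ ℕ-Solver.solve (q ∷ []) ⟩
  4 *ℕ q                                       ≡⟨ n²+1≡4q ⟨
  (1 +ℕ 2 *ℕ i) *ℕ (1 +ℕ 2 *ℕ i) +ℕ 1         ≡⟨ ℕ-Solver.solve (i ∷ []) ⟩
  2 *ℕ (1 +ℕ 2 *ℕ (i *ℕ i +ℕ i))               ∎))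

data Parity : ℤ → Set where
  even : ∀ c → Parity (+ 2 * c)
  odd  : ∀ c → Parity (+ 2 * c + + 1)

parity : ∀ a → Parity a
parity a with a % + 2 | n%d<d a (+ 2) | a≡a%n+[a/n]*n a (+ 2)
... | 0 | _ | a≡0+q*2 = subst Parity (sym (trans a≡0+q*2 (0+q*2≡2*q (a / + 2)))) (even (a / + 2))
  where
  0+q*2≡2*q : ∀ q → + 0 + q * + 2 ≡ + 2 * q
  0+q*2≡2*q = solve-∀
... | 1 | _ | a≡1+q*2 = subst Parity (sym (trans a≡1+q*2 (1+q*2≡2*q+1 (a / + 2)))) (odd (a / + 2))
  where
  1+q*2≡2*q+1 : ∀ q → + 1 + q * + 2 ≡ + 2 * q + + 1
  1+q*2≡2*q+1 = solve-∀
... | suc (suc _) | s≤s (s≤s ()) | _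

odd≢even : ∀ s t → + 2 * s + + 1 ≢ + 2 * t
odd≢even s t eq = ℕ.even≢odd ∣ t - s ∣ 0 (sym (trans (cong ∣_∣ 1≡2[t-s]) (abs-* (+ 2) (t - s))))
  where
  1≡2[t-s] : + 1 ≡ + 2 * (t - s)
  1≡2[t-s] = begin
    + 1                            ≡⟨ solve (s ∷ []) ⟩
    (+ 2 * s + + 1) - + 2 * s      ≡⟨ cong (_- + 2 * s) eq ⟩
    + 2 * t - + 2 * s              ≡⟨ solve (s ∷ t ∷ []) ⟩
    + 2 * (t - s)                  ∎

i*i≡+∣i∣*∣i∣ : ∀ i → i * i ≡ + (∣ i ∣ *ℕ ∣ i ∣)
i*i≡+∣i∣*∣i∣ (+ n) = sym (pos-* n n)
i*i≡+∣i∣*∣i∣ -[1+ n ] = refl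

u²+7v²≡4⇒v≡0 : ∀ u v → u *ℕ u +ℕ 7 *ℕ (v *ℕ v) ≡ 4 → v ≡ 0
u²+7v²≡4⇒v≡0 u zero _ = refl
u²+7v²≡4⇒v≡0 u (suc v) eq = contradiction 7≤4 (from-no (7 ℕ.≤? 4))
  where
  7≤4 : 7 ℕ.≤ 4
  7≤4 = ℕ.≤-trans (ℕ.m≤m*n 7 (suc v *ℕ suc v)) (ℕ.≤-trans (ℕ.m≤n+m _ (u *ℕ u)) (ℕ.≤-reflexive eq))

-- Galois conjugation a + bθ ↦ a + bθ' = (a + b) - bθ.
conj : 𝒪 → 𝒪
conj ⟨ a , b ⟩ = ⟨ a + b , - b ⟩

norm : 𝒪 → ℤ
norm ⟨ a , b ⟩ = a * a + a * b + + 2 * (b * b)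

𝟚 : 𝒪
𝟚 = ι (+ 2)

-- The ring solver does not unfold _*𝒪_, so the laws below are stated coordinatewise.
*𝒪-comm : ∀ x y → x *𝒪 y ≡ y *𝒪 x
*𝒪-comm ⟨ a , b ⟩ ⟨ c , d ⟩ = cong₂ ⟨_,_⟩ (re-comm a b c d) (th-comm a b c d)
  where
  re-comm : ∀ a b c d → a * c - + 2 * (b * d) ≡ c * a - + 2 * (d * b)
  re-comm = solve-∀
  th-comm : ∀ a b c d → a * d + b * c + b * d ≡ c * b + d * a + d * b
  th-comm = solve-∀

*𝒪-assoc : ∀ x y z → (x *𝒪 y) *𝒪 z ≡ x *𝒪 (y *𝒪 z)
*𝒪-assoc ⟨ a , b ⟩ ⟨ c , d ⟩ ⟨ e , f ⟩ = cong₂ ⟨_,_⟩ (re-assoc a b c d e f) (th-assoc a b c d e f)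
  where
  re-assoc : ∀ a b c d e f →
    (a * c - + 2 * (b * d)) * e - + 2 * ((a * d + b * c + b * d) * f)
      ≡ a * (c * e - + 2 * (d * f)) - + 2 * (b * (c * f + d * e + d * f))
  re-assoc = solve-∀
  th-assoc : ∀ a b c d e f →
    (a * c - + 2 * (b * d)) * f + (a * d + b * c + b * d) * e + (a * d + b * c + b * d) * f
      ≡ a * (c * f + d * e + d * f) + b * (c * e - + 2 * (d * f)) + b * (c * f + d * e + d * f)
  th-assoc = solve-∀

*𝒪-negʳ : ∀ x y → x *𝒪 (-𝒪 y) ≡ -𝒪 (x *𝒪 y)
*𝒪-negʳ ⟨ a , b ⟩ ⟨ c , d ⟩ = cong₂ ⟨_,_⟩ (re-neg a b c d) (th-neg a b c d)
  where
  re-neg : ∀ a b c d → a * - c - + 2 * (b * - d) ≡ - (a * c - + 2 * (b * d))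
  re-neg = solve-∀
  th-neg : ∀ a b c d → a * - d + b * - c + b * - d ≡ - (a * d + b * c + b * d)
  th-neg = solve-∀

conj-*𝒪 : ∀ x y → conj (x *𝒪 y) ≡ conj x *𝒪 conj y
conj-*𝒪 ⟨ a , b ⟩ ⟨ c , d ⟩ = cong₂ ⟨_,_⟩ (re-conj a b c d) (th-conj a b c d)
  where
  re-conj : ∀ a b c d →
    a * c - + 2 * (b * d) + (a * d + b * c + b * d) ≡ (a + b) * (c + d) - + 2 * (- b * - d)
  re-conj = solve-∀
  th-conj : ∀ a b c d → - (a * d + b * c + b * d) ≡ (a + b) * - d + - b * (c + d) + - b * - d
  th-conj = solve-∀

norm-*𝒪 : ∀ x y → norm (x *𝒪 y) ≡ norm x * norm y
norm-*𝒪 ⟨ a , b ⟩ ⟨ c , d ⟩ = norm-mult a b c d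
  where
  norm-mult : ∀ a b c d →
    (a * c - + 2 * (b * d)) * (a * c - + 2 * (b * d))
      + (a * c - + 2 * (b * d)) * (a * d + b * c + b * d)
      + + 2 * ((a * d + b * c + b * d) * (a * d + b * c + b * d))
      ≡ (a * a + a * b + + 2 * (b * b)) * (c * c + c * d + + 2 * (d * d))
  norm-mult = solve-∀

θ-*𝒪 : ∀ u v → θ *𝒪 ⟨ u , v ⟩ ≡ ⟨ - (+ 2 * v) , u + v ⟩
θ-*𝒪 u v = cong₂ ⟨_,_⟩ (re-θ u v) (th-θ u v)
  where
  re-θ : ∀ u v → + 0 * u - + 2 * (+ 1 * v) ≡ - (+ 2 * v)
  re-θ = solve-∀
  th-θ : ∀ u v → + 0 * v + + 1 * u + + 1 * v ≡ u + v
  th-θ = solve-∀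

θ'-*𝒪 : ∀ u v → θ' *𝒪 ⟨ u , v ⟩ ≡ ⟨ u + + 2 * v , - u ⟩
θ'-*𝒪 u v = cong₂ ⟨_,_⟩ (re-θ' u v) (th-θ' u v)
  where
  re-θ' : ∀ u v → + 1 * u - + 2 * (- + 1 * v) ≡ u + + 2 * v
  re-θ' = solve-∀
  th-θ' : ∀ u v → + 1 * v + - + 1 * u + - + 1 * v ≡ - u
  th-θ' = solve-∀

θ'^n≡conj-θ^n : ∀ n → θ' ^𝒪 n ≡ conj (θ ^𝒪 n)
θ'^n≡conj-θ^n zero = refl
θ'^n≡conj-θ^n (suc n) = trans (cong (θ' *𝒪_) (θ'^n≡conj-θ^n n)) (sym (conj-*𝒪 θ (θ ^𝒪 n)))

x-conj-x : ∀ x → x -𝒪 conj x ≡ ⟨ - th x , + 2 * th x ⟩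
x-conj-x ⟨ a , b ⟩ = cong₂ ⟨_,_⟩ (re-diff a b) (th-diff b)
  where
  re-diff : ∀ a b → a + - (a + b) ≡ - b
  re-diff = solve-∀
  th-diff : ∀ b → b + - - b ≡ + 2 * b
  th-diff = solve-∀

infix 4 _∣𝒪_ _≡±_

_∣𝒪_ : 𝒪 → 𝒪 → Set
δ ∣𝒪 α = ∃ λ γ → δ *𝒪 γ ≡ α

∣𝒪-*ˡ : ∀ {δ β} π → δ ∣𝒪 β → δ ∣𝒪 π *𝒪 β
∣𝒪-*ˡ {δ} π (γ , refl) = π *𝒪 γ , (begin
  δ *𝒪 (π *𝒪 γ)  ≡⟨ sym (*𝒪-assoc δ π γ) ⟩
  (δ *𝒪 π) *𝒪 γ  ≡⟨ cong (_*𝒪 γ) (*𝒪-comm δ π) ⟩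
  (π *𝒪 δ) *𝒪 γ  ≡⟨ *𝒪-assoc π δ γ ⟩
  π *𝒪 (δ *𝒪 γ)  ∎)

data _≡±_ (α β : 𝒪) : Set where
  plus  : α ≡ β → α ≡± β
  minus : α ≡ -𝒪 β → α ≡± β

*𝒪-congˡ-≡± : ∀ π {α β} → α ≡± β → π *𝒪 α ≡± π *𝒪 β
*𝒪-congˡ-≡± π (plus refl) = plus refl
*𝒪-congˡ-≡± π {β = β} (minus refl) = minus (*𝒪-negʳ π β)

∣𝒪-resp-≡± : ∀ {δ α β} → α ≡± β → δ ∣𝒪 β → δ ∣𝒪 α
∣𝒪-resp-≡± (plus refl) δ∣β = δ∣β
∣𝒪-resp-≡± {δ} (minus refl) (γ , refl) = -𝒪 γ , *𝒪-negʳ δ γ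

th-≡± : ∀ {α β} → α ≡± β → th β ≡ th α ⊎ th β ≡ - th α
th-≡± (plus refl) = inj₁ refl
th-≡± (minus refl) = inj₂ (sym (neg-involutive _))

a²≡1⇒ιa≡±𝟙 : ∀ a → a * a ≡ + 1 → ι a ≡± 𝟙
a²≡1⇒ιa≡±𝟙 (+ 1) _ = plus refl
a²≡1⇒ιa≡±𝟙 -[1+ 0 ] _ = minus refl
a²≡1⇒ιa≡±𝟙 (+ 0) ()
a²≡1⇒ιa≡±𝟙 (+ suc (suc n)) ()
a²≡1⇒ιa≡±𝟙 -[1+ suc n ] ()

-- 4 N(a + bθ) = (2a + b)² + 7b², so a unit has b = 0.
norm≡1⇒≡±𝟙 : ∀ α → norm α ≡ + 1 → α ≡± 𝟙
norm≡1⇒≡±𝟙 ⟨ a , b ⟩ norm≡1 with ∣i∣≡0⇒i≡0 {b} (u²+7v²≡4⇒v≡0 ∣ u ∣ ∣ b ∣ (+-injective 4N≡4))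
  where
  u = + 2 * a + b
  4N≡4 : + (∣ u ∣ *ℕ ∣ u ∣ +ℕ 7 *ℕ (∣ b ∣ *ℕ ∣ b ∣)) ≡ + 4
  4N≡4 = begin
    + (∣ u ∣ *ℕ ∣ u ∣ +ℕ 7 *ℕ (∣ b ∣ *ℕ ∣ b ∣))
      ≡⟨ pos-+ (∣ u ∣ *ℕ ∣ u ∣) (7 *ℕ (∣ b ∣ *ℕ ∣ b ∣)) ⟩
    + (∣ u ∣ *ℕ ∣ u ∣) + + (7 *ℕ (∣ b ∣ *ℕ ∣ b ∣))
      ≡⟨ cong (_+_ (+ (∣ u ∣ *ℕ ∣ u ∣))) (pos-* 7 (∣ b ∣ *ℕ ∣ b ∣)) ⟩
    + (∣ u ∣ *ℕ ∣ u ∣) + + 7 * + (∣ b ∣ *ℕ ∣ b ∣)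
      ≡⟨ cong₂ (λ p q → p + + 7 * q) (i*i≡+∣i∣*∣i∣ u) (i*i≡+∣i∣*∣i∣ b) ⟨
    (+ 2 * a + b) * (+ 2 * a + b) + + 7 * (b * b)
      ≡⟨ solve (a ∷ b ∷ []) ⟩
    + 4 * (a * a + a * b + + 2 * (b * b))
      ≡⟨ cong (+ 4 *_) norm≡1 ⟩
    + 4 ∎
... | refl = a²≡1⇒ιa≡±𝟙 a (trans (a*a≡norm a) norm≡1)
  where
  a*a≡norm : ∀ a → a * a ≡ a * a + a * + 0 + + 2 * (+ 0 * + 0)
  a*a≡norm = solve-∀

-- θ divides a + bθ when a is even, θ' when a and b are both odd; otherwise the norm is odd.
θ∣⊎θ'∣ : ∀ k α → norm α ≡ + (2 ^ℕ suc k) → θ ∣𝒪 α ⊎ θ' ∣𝒪 α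
θ∣⊎θ'∣ k ⟨ a , b ⟩ norm≡2^k+1 with parity a | parity b
... | even c | _ = inj₁ (⟨ b + c , - c ⟩ , (begin
  θ *𝒪 ⟨ b + c , - c ⟩           ≡⟨ θ-*𝒪 (b + c) (- c) ⟩
  ⟨ - (+ 2 * - c) , b + c - c ⟩  ≡⟨ cong₂ ⟨_,_⟩ (solve (c ∷ [])) (solve (b ∷ c ∷ [])) ⟩
  ⟨ + 2 * c , b ⟩                ∎))
... | odd c | odd d = inj₂ (⟨ - (+ 2 * d + + 1) , c + d + + 1 ⟩ , (begin
  θ' *𝒪 ⟨ - (+ 2 * d + + 1) , c + d + + 1 ⟩
    ≡⟨ θ'-*𝒪 (- (+ 2 * d + + 1)) (c + d + + 1) ⟩
  ⟨ - (+ 2 * d + + 1) + + 2 * (c + d + + 1) , - - (+ 2 * d + + 1) ⟩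
    ≡⟨ cong₂ ⟨_,_⟩ (solve (c ∷ d ∷ [])) (solve (d ∷ [])) ⟩
  ⟨ + 2 * c + + 1 , + 2 * d + + 1 ⟩ ∎))
... | odd c | even d =
  ⊥-elim (odd≢even (+ 2 * c * c + + 2 * c + + 2 * c * d + d + + 4 * d * d) (+ (2 ^ℕ k)) (begin
  + 2 * (+ 2 * c * c + + 2 * c + + 2 * c * d + d + + 4 * d * d) + + 1
    ≡⟨ solve (c ∷ d ∷ []) ⟩
  (+ 2 * c + + 1) * (+ 2 * c + + 1) + (+ 2 * c + + 1) * (+ 2 * d) + + 2 * (+ 2 * d * (+ 2 * d))
    ≡⟨ norm≡2^k+1 ⟩
  + (2 ^ℕ suc k)
    ≡⟨ pos-* 2 (2 ^ℕ k) ⟩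
  + 2 * + (2 ^ℕ k) ∎))

norm-*𝒪-cancelˡ : ∀ k π β → norm π ≡ + 2 → norm (π *𝒪 β) ≡ + (2 ^ℕ suc k) → norm β ≡ + (2 ^ℕ k)
norm-*𝒪-cancelˡ k π β norm-π≡2 norm≡2^k+1 = *-cancelˡ-≡ (+ 2) (norm β) (+ (2 ^ℕ k)) (begin
  + 2 * norm β          ≡⟨ cong (_* norm β) (sym norm-π≡2) ⟩
  norm π * norm β       ≡⟨ sym (norm-*𝒪 π β) ⟩
  norm (π *𝒪 β)         ≡⟨ norm≡2^k+1 ⟩
  + (2 ^ℕ suc k)        ≡⟨ pos-* 2 (2 ^ℕ k) ⟩
  + 2 * + (2 ^ℕ k)      ∎)

-- β = ±π'^(k+1) is impossible, as it would make πβ = ±2π'^k divisible by 2.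
π*≡±π^-step : ∀ {π π'} → π *𝒪 π' ≡ 𝟚 → ∀ k {β} → ¬ 𝟚 ∣𝒪 π *𝒪 β →
              β ≡± π ^𝒪 k ⊎ β ≡± π' ^𝒪 k → π *𝒪 β ≡± π ^𝒪 suc k
π*≡±π^-step {π} _ k _ (inj₁ β≡±π^k) = *𝒪-congˡ-≡± π β≡±π^k
π*≡±π^-step {π} _ zero _ (inj₂ β≡±𝟙) = *𝒪-congˡ-≡± π β≡±𝟙
π*≡±π^-step {π} {π'} ππ'≡𝟚 (suc k) 𝟚∤πβ (inj₂ β≡±π'^k+1) =
  ⊥-elim (𝟚∤πβ (∣𝒪-resp-≡± {𝟚} (*𝒪-congˡ-≡± π β≡±π'^k+1) (π' ^𝒪 k , (begin
    𝟚 *𝒪 π' ^𝒪 k               ≡⟨ cong (_*𝒪 π' ^𝒪 k) (sym ππ'≡𝟚) ⟩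
    (π *𝒪 π') *𝒪 π' ^𝒪 k       ≡⟨ *𝒪-assoc π π' (π' ^𝒪 k) ⟩
    π *𝒪 π' ^𝒪 suc k           ∎))))

norm≡2^k⇒≡±θ^k⊎θ'^k : ∀ k α → norm α ≡ + (2 ^ℕ k) → ¬ 𝟚 ∣𝒪 α →
                      α ≡± θ ^𝒪 k ⊎ α ≡± θ' ^𝒪 k
norm≡2^k⇒≡±θ^k⊎θ'^k zero α norm≡1 _ = inj₁ (norm≡1⇒≡±𝟙 α norm≡1)
norm≡2^k⇒≡±θ^k⊎θ'^k (suc k) α norm≡2^k+1 𝟚∤α with θ∣⊎θ'∣ k α norm≡2^k+1
... | inj₁ (β , refl) = inj₁ (π*≡±π^-step refl k 𝟚∤α (norm≡2^k⇒≡±θ^k⊎θ'^k k β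
        (norm-*𝒪-cancelˡ k θ β refl norm≡2^k+1) (𝟚∤α ∘ ∣𝒪-*ˡ {𝟚} θ)))
... | inj₂ (β , refl) = inj₂ (π*≡±π^-step refl k 𝟚∤α (swap (norm≡2^k⇒≡±θ^k⊎θ'^k k β
        (norm-*𝒪-cancelˡ k θ' β refl norm≡2^k+1) (𝟚∤α ∘ ∣𝒪-*ˡ {𝟚} θ'))))

𝟚∤a+θ : ∀ a → ¬ 𝟚 ∣𝒪 ⟨ a , + 1 ⟩
𝟚∤a+θ a (⟨ p , q ⟩ , 𝟚γ≡a+θ) = odd≢even (+ 0) q (begin
  + 1                               ≡⟨ sym (cong th 𝟚γ≡a+θ) ⟩
  + 2 * q + + 0 * p + + 0 * q       ≡⟨ solve (p ∷ q ∷ []) ⟩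
  + 2 * q                           ∎)

-- θⁿ - θ'ⁿ = τ n · √-7, where √-7 = θ - θ'.
τ : ℕ → ℤ
τ n = th (θ ^𝒪 n)

θ^n-θ'^n≡τ√-7 : ∀ n → θ ^𝒪 n -𝒪 θ' ^𝒪 n ≡ ⟨ - τ n , + 2 * τ n ⟩
θ^n-θ'^n≡τ√-7 n = trans (cong (λ y → θ ^𝒪 n -𝒪 y) (θ'^n≡conj-θ^n n)) (x-conj-x (θ ^𝒪 n))

τ-rec : ∀ n → τ (suc (suc n)) ≡ τ (suc n) - + 2 * τ n
τ-rec n = begin
  th (θ *𝒪 (θ *𝒪 θ ^𝒪 n))                        ≡⟨ cong (th ∘ (θ *𝒪_)) θ^n+1≡ ⟩
  th (θ *𝒪 ⟨ - (+ 2 * τ n) , r + τ n ⟩)          ≡⟨ cong th (θ-*𝒪 (- (+ 2 * τ n)) (r + τ n)) ⟩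
  - (+ 2 * τ n) + (r + τ n)                      ≡⟨ reorder r (τ n) ⟩
  r + τ n - + 2 * τ n                            ≡⟨ cong (λ t → th t - + 2 * τ n) θ^n+1≡ ⟨
  τ (suc n) - + 2 * τ n                          ∎
  where
  r = re (θ ^𝒪 n)
  θ^n+1≡ : θ ^𝒪 suc n ≡ ⟨ - (+ 2 * τ n) , r + τ n ⟩
  θ^n+1≡ = θ-*𝒪 r (τ n)
  reorder : ∀ r t → - (+ 2 * t) + (r + t) ≡ r + t - + 2 * t
  reorder = solve-∀

τ-mod-4 : ∀ k → (∃ λ s → τ (2 +ℕ 2 *ℕ k) ≡ + 4 * s + + 1)
              × (∃ λ t → τ (3 +ℕ 2 *ℕ k) ≡ + 4 * t + + 3)
τ-mod-4 zero = (+ 0 , refl) , (- + 1 , refl)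
τ-mod-4 (suc k) with τ-mod-4 k
... | (s , τ₂≡4s+1) , (t , τ₃≡4t+3) =
  (t - + 2 * s , trans (shift 2) τ₄≡) , (- t - + 2 * s - + 2 , trans (shift 3) τ₅≡)
  where
  n = 2 *ℕ k
  shift : ∀ i → τ (i +ℕ 2 *ℕ suc k) ≡ τ (i +ℕ (2 +ℕ n))
  shift i = cong (λ l → τ (i +ℕ l)) (ℕ.*-suc 2 k)
  τ₄≡ : τ (4 +ℕ n) ≡ + 4 * (t - + 2 * s) + + 1
  τ₄≡ = begin
    τ (4 +ℕ n)                              ≡⟨ τ-rec (2 +ℕ n) ⟩
    τ (3 +ℕ n) - + 2 * τ (2 +ℕ n)           ≡⟨ cong₂ (λ u v → u - + 2 * v) τ₃≡4t+3 τ₂≡4s+1 ⟩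
    (+ 4 * t + + 3) - + 2 * (+ 4 * s + + 1) ≡⟨ solve (s ∷ t ∷ []) ⟩
    + 4 * (t - + 2 * s) + + 1               ∎
  τ₅≡ : τ (5 +ℕ n) ≡ + 4 * (- t - + 2 * s - + 2) + + 3
  τ₅≡ = begin
    τ (5 +ℕ n)                                       ≡⟨ τ-rec (3 +ℕ n) ⟩
    τ (4 +ℕ n) - + 2 * τ (3 +ℕ n)                    ≡⟨ cong₂ (λ u v → u - + 2 * v) τ₄≡ τ₃≡4t+3 ⟩
    (+ 4 * (t - + 2 * s) + + 1) - + 2 * (+ 4 * t + + 3) ≡⟨ solve (s ∷ t ∷ []) ⟩
    + 4 * (- t - + 2 * s - + 2) + + 3                ∎

4t+3≢1 : ∀ t → + 4 * t + + 3 ≢ + 1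
4t+3≢1 t eq = odd≢even t (+ 0) (*-cancelˡ-≡ (+ 2) (+ 2 * t + + 1) (+ 0) (begin
  + 2 * (+ 2 * t + + 1)     ≡⟨ solve (t ∷ []) ⟩
  + 4 * t + + 3 - + 1       ≡⟨ cong (_- + 1) eq ⟩
  + 0                       ∎))

τ≡±1 : ∀ m j → norm ⟨ j , + 1 ⟩ ≡ + (2 ^ℕ m) → τ m ≡ + 1 ⊎ τ m ≡ - + 1
τ≡±1 m j norm≡2^m with norm≡2^k⇒≡±θ^k⊎θ'^k m ⟨ j , + 1 ⟩ norm≡2^m (𝟚∤a+θ j)
... | inj₁ j+θ≡±θ^m = th-≡± j+θ≡±θ^m
... | inj₂ j+θ≡±θ'^m =
  swap (⊎-map neg-injective neg-injective (subst (λ t → t ≡ + 1 ⊎ t ≡ - + 1) th-θ'^m (th-≡± j+θ≡±θ'^m)))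
  where
  th-θ'^m : th (θ' ^𝒪 m) ≡ - τ m
  th-θ'^m = cong th (θ'^n≡conj-θ^n m)

τ-odd≡-1 : ∀ k j → norm ⟨ j , + 1 ⟩ ≡ + (2 ^ℕ (3 +ℕ 2 *ℕ k)) → τ (3 +ℕ 2 *ℕ k) ≡ - + 1
τ-odd≡-1 k j norm≡2^m with τ≡±1 (3 +ℕ 2 *ℕ k) j norm≡2^m | τ-mod-4 k
... | inj₁ τ≡1 | _ , (t , τ≡4t+3) = ⊥-elim (4t+3≢1 t (trans (sym τ≡4t+3) τ≡1))
... | inj₂ τ≡-1 | _ = τ≡-1

-- For odd n = 2j + 1, n² + 7 = 4 (j² + j + 2); even n would give j² + 1 = 2^m with m ≥ 2.
⌊n²+7/4⌋≡2^m⇒j²+j+2≡2^m : ∀ n m → (n *ℕ n +ℕ 7) ℕ./ 4 ≡ 2 ^ℕ (2 +ℕ m) →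
                          ∃ λ j → j *ℕ j +ℕ j +ℕ 2 ≡ 2 ^ℕ (2 +ℕ m)
⌊n²+7/4⌋≡2^m⇒j²+j+2≡2^m n m ⌊n²+7/4⌋≡2^m with parityℕ n
... | odd j = j , (begin
  j *ℕ j +ℕ j +ℕ 2                                  ≡⟨ ℕ.m*n/n≡m (j *ℕ j +ℕ j +ℕ 2) 4 ⟨
  (j *ℕ j +ℕ j +ℕ 2) *ℕ 4 ℕ./ 4                     ≡⟨ cong (ℕ._/ 4) (odd² j) ⟩
  ((1 +ℕ 2 *ℕ j) *ℕ (1 +ℕ 2 *ℕ j) +ℕ 7) ℕ./ 4      ≡⟨ ⌊n²+7/4⌋≡2^m ⟩
  2 ^ℕ (2 +ℕ m)                                     ∎)
  where
  odd² : ∀ j → (j *ℕ j +ℕ j +ℕ 2) *ℕ 4 ≡ (1 +ℕ 2 *ℕ j) *ℕ (1 +ℕ 2 *ℕ j) +ℕ 7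
  odd² = ℕ-Solver.solve-∀
... | even j = ⊥-elim (n²+1≢4*q j (2 ^ℕ m) (begin
  j *ℕ j +ℕ 1                                       ≡⟨ ℕ.m*n/n≡m (j *ℕ j +ℕ 1) 4 ⟨
  (j *ℕ j +ℕ 1) *ℕ 4 ℕ./ 4                          ≡⟨ ℕ.+-distrib-/-∣ʳ 3 {d = 4} (n∣m*n (j *ℕ j +ℕ 1)) ⟨
  (3 +ℕ (j *ℕ j +ℕ 1) *ℕ 4) ℕ./ 4                   ≡⟨ cong (ℕ._/ 4) (even² j) ⟩
  (2 *ℕ j *ℕ (2 *ℕ j) +ℕ 7) ℕ./ 4                   ≡⟨ ⌊n²+7/4⌋≡2^m ⟩
  2 *ℕ (2 *ℕ 2 ^ℕ m)                                ≡⟨ ℕ.*-assoc 2 2 (2 ^ℕ m) ⟨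
  4 *ℕ 2 ^ℕ m                                       ∎))
  where
  even² : ∀ j → 3 +ℕ (j *ℕ j +ℕ 1) *ℕ 4 ≡ 2 *ℕ j *ℕ (2 *ℕ j) +ℕ 7
  even² = ℕ-Solver.solve-∀

norm⟨j,1⟩≡j²+j+2 : ∀ j → norm ⟨ + j , + 1 ⟩ ≡ + (j *ℕ j +ℕ j +ℕ 2)
norm⟨j,1⟩≡j²+j+2 j = begin
  + j * + j + + j * + 1 + + 2      ≡⟨ cong₂ (λ u v → u + v + + 2) (pos-* j j) (sym (*-identityʳ (+ j))) ⟨
  + (j *ℕ j) + + j + + 2           ≡⟨ cong (_+ + 2) (pos-+ (j *ℕ j) j) ⟨
  + (j *ℕ j +ℕ j) + + 2            ≡⟨ pos-+ (j *ℕ j +ℕ j) 2 ⟨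
  + (j *ℕ j +ℕ j +ℕ 2)             ∎

⌊x²+7/4⌋≡2^m⇒norm≡2^m : ∀ x m → (x * x + + 7) / + 4 ≡ + (2 ^ℕ (2 +ℕ m)) →
                        ∃ λ j → norm ⟨ j , + 1 ⟩ ≡ + (2 ^ℕ (2 +ℕ m))
⌊x²+7/4⌋≡2^m⇒norm≡2^m x m ⌊x²+7/4⌋≡2^m
  with ⌊n²+7/4⌋≡2^m⇒j²+j+2≡2^m ∣ x ∣ m (+-injective (begin
  + ((∣ x ∣ *ℕ ∣ x ∣ +ℕ 7) ℕ./ 4)     ≡⟨ div-pos-is-/ℕ (+ (∣ x ∣ *ℕ ∣ x ∣ +ℕ 7)) 4 ⟨
  + (∣ x ∣ *ℕ ∣ x ∣ +ℕ 7) / + 4       ≡⟨ cong (_/ + 4) x²+7≡ ⟨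
  (x * x + + 7) / + 4                 ≡⟨ ⌊x²+7/4⌋≡2^m ⟩
  + (2 ^ℕ (2 +ℕ m))                   ∎))
  where
  x²+7≡ : x * x + + 7 ≡ + (∣ x ∣ *ℕ ∣ x ∣ +ℕ 7)
  x²+7≡ = trans (cong (_+ + 7) (i*i≡+∣i∣*∣i∣ x)) (sym (pos-+ (∣ x ∣ *ℕ ∣ x ∣) 7))
... | j , j²+j+2≡2^m = + j , trans (norm⟨j,1⟩≡j²+j+2 j) (cong +_ j²+j+2≡2^m)

odd≥3⇒≡3+2k : ∀ {m} → (∃ λ k → m ≡ 2 *ℕ k +ℕ 1) → m ≥ 3 → ∃ λ k → m ≡ 3 +ℕ 2 *ℕ k
odd≥3⇒≡3+2k (zero , refl) (s≤s ())
odd≥3⇒≡3+2k (suc k , refl) _ = k , ℕ-Solver.solve (k ∷ [])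

mainTheorem2 : (x : ℤ) (m : ℕ) → (∃ λ k → m ≡ 2 *ℕ k +ℕ 1) → m ≥ 3 →
    (x * x + + 7) / (+ 4) ≡ + (2 ^ℕ m) →
    (-𝒪 (ι (+ 2) *𝒪 θ)) +𝒪 𝟙 ≡ θ ^𝒪 m -𝒪 θ' ^𝒪 m
mainTheorem2 x m m-odd m≥3 ⌊x²+7/4⌋≡2^m with odd≥3⇒≡3+2k m-odd m≥3
... | k , refl with ⌊x²+7/4⌋≡2^m⇒norm≡2^m x (1 +ℕ 2 *ℕ k) ⌊x²+7/4⌋≡2^m
... | j , norm≡2^m = begin
  (-𝒪 (ι (+ 2) *𝒪 θ)) +𝒪 𝟙       ≡⟨⟩
  ⟨ - - + 1 , + 2 * - + 1 ⟩       ≡⟨ cong (λ t → ⟨ - t , + 2 * t ⟩) (τ-odd≡-1 k j norm≡2^m) ⟨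
  ⟨ - τ m , + 2 * τ m ⟩           ≡⟨ θ^n-θ'^n≡τ√-7 m ⟨
  θ ^𝒪 m -𝒪 θ' ^𝒪 m               ∎
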